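{- Let $T$ be a weighted monogamous trigraph and $(X,Y)$ a decomposition of $T$, and let $T_Y$ be the corresponding weighted block. Then $\alpha(T)=\alpha(T_Y)$.
   Context: A trigraph $T$ consists of a finite vertex set $V(T)$ and a map $\theta:\binom{V(T)}{2}\to\{ -1,0,1\}$. Distinct $u,v$ are strongly adjacent if $\theta(uv)=1$, strongly antiadjacent if $\theta(uv)=-1$, semiadjacent (a switchable pair) if $\theta(uv)=0$; antiadjacent if $\theta(uv)\in\{ -1,0\}$. $T[X]$ is the restriction to $X$. A stable set is a set of pairwise antiadjacent vertices. $T$ is monogamous if every vertex is in at most one switchable pair. A weighted trigraph has a weight $w(a)\in\mathbb{Z}_{\ge0}$ on each vertex and $w(ab)\in\mathbb{Z}_{\ge0}$ on each switchable pair with $\max\{w(a),w(b)\}\le w(ab)\le w(a)+w(b)$. For a stable set $S$, $c(S)$ is the set of $v\in S$ strongly antiadjacent to all other vertices of $S$ and $\sigma(S)$ the set of switchable pairs inside $S$; the weight of $S$ is $\sum_{v\in c(S)}w(v)+\sum_{uv\in\sigma(S)}w(uv)$, and $\alpha(T)$ is the maximum weight of a stable set of $T$. A vertex $b\notin A$ is strongly complete (strongly anticomplete) to $A$ if strongly adjacent (strongly antiadjacent) to all of $A$; a set is so if all its vertices are. A homogeneous set is a set $X$ with $1<|X|<|V(T)|$ such that every vertex outside $X$ is strongly complete or strongly anticomplete to $X$. A homogeneous pair is a pair $(A,B)$ of disjoint nonempty sets with a split $(A,B,C,D,E,F)$, where $C,D,E,F$ are disjoint (possibly empty) with union $V(T)\setminus(A\cup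 B)$, such that $A$ is strongly complete to $C\cup E$ and strongly anticomplete to $D\cup F$, $B$ is strongly complete to $D\cup E$ and strongly anticomplete to $C\cup F$, $A$ is neither strongly complete nor strongly anticomplete to $B$, $|A\cup B|\ge3$ and $|C\cup D\cup E\cup F|\ge3$; it is small if $|A\cup B|\le6$ and proper if $C\ne\emptyset\ne D$. A decomposition is a partition $(X,Y)$ of $V(T)$ where $X$ is a homogeneous set or $X=A\cup B$ with $(A,B)$ a small or proper homogeneous pair. The weighted block $T_Y$: if $X$ is a homogeneous set, $T_Y=T[Y\cup\{x\}]$ for some $x\in X$, where $x$ gets weight $\alpha(T[X])$ and all other weights are kept; if $X=A\cup B$ with split $(A,B,C,D,E,F)$, $T_Y$ is $T[Y]$ (weights kept) plus new vertices $a,b$ with $a$ strongly complete to $C\cup E$ and strongly anticomplete to $D\cup F$, $b$ strongly complete to $D\cup E$ and strongly anticomplete to $C\cup F$, $ab$ a switchable pair, and weights $w(a)=\alpha(T[A])$, $w(b)=\alpha(T[B])$, $w(ab)=\alpha(T[A\cup B])$. -}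

module Defs where

open import Data.Nat using (ℕ; zero; suc; _+_; _≤_; _<_; _⊔_)
open import Data.Bool using (Bool; true; false; if_then_else_; _∧_; _∨_; not)
open import Data.List using (List; []; _∷_; map; _++_; foldr; length; filterᵇ)
open import Data.Nat.ListAction using (sum)
open import Data.Bool.ListAction using (all)
open import Data.List.Membership.Propositional using (_∈_)
open import Data.List.Relation.Unary.Unique.Propositional using (Unique)
open import Data.Product using (Σ; _×_; _,_; ∃)
open import Data.Sum using (_⊎_)
open import Data.Unit using (⊤)
open import Relation.Nullary using (¬_; yes; no)
open import Relation.Binary.PropositionalEquality using (_≡_; _≢_)
open import Relation.Binary.Definitions using (DecidableEquality)

-- Adjacency values: θ = 1 (strong), 0 (semi / switchable), -1 (anti)

data Adj : Set where
  strong semi anti : Adj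

isStrong isSemi isAnti : Adj → Bool
isStrong strong = true
isStrong _      = false
isSemi semi = true
isSemi _    = false
isAnti anti = true
isAnti _    = false

-- V(T) is the finite list `verts` (required to be duplicate free, see WF).
-- θ is only meaningful on pairs of distinct vertices of V(T);
-- w is the vertex weight, wp the weight of a (switchable) pair.

record Trigraph (V : Set) : Set where
  field
    verts : List V
    θ     : V → V → Adj
    w     : V → ℕ
    wp    : V → V → ℕ
open Trigraph public

-- well-formedness: V(T) is a set, θ and wp are functions of unordered pairs
record WellFormed {V : Set} (T : Trigraph V) : Set where
  field
    uniq    : Unique (verts T)
    θ-sym   : ∀ u v → u ∈ verts T → v ∈ verts T → θ T u v ≡ θ T v u
    wp-sym  : ∀ u v → u ∈ verts T → v ∈ verts T → wp T u v ≡ wp T v u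

record Weighted {V : Set} (T : Trigraph V) : Set where
  field
    wf     : WellFormed T
    bounds : ∀ u v → u ∈ verts T → v ∈ verts T → u ≢ v → θ T u v ≡ semi →
             (w T u ⊔ w T v ≤ wp T u v) × (wp T u v ≤ w T u + w T v)

Monogamous : {V : Set} → Trigraph V → Set
Monogamous T = ∀ u v v' → u ∈ verts T → v ∈ verts T → v' ∈ verts T →
  u ≢ v → u ≢ v' → θ T u v ≡ semi → θ T u v' ≡ semi → v ≡ v'

restrict : {V : Set} → Trigraph V → (V → Bool) → Trigraph V
restrict T X = record T { verts = filterᵇ X (verts T) }

-- Stable sets and α. Subsets of V(T) are represented as sublists
-- (subsequences) of the duplicate-free list verts.

subsequences : {A : Set} → List A → List (List A)
subsequences []       = [] ∷ []
subsequences (x ∷ xs) = map (x ∷_) (subsequences xs) ++ subsequences xs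

pairs : {A : Set} → List A → List (A × A)
pairs []       = []
pairs (x ∷ xs) = map (x ,_) xs ++ pairs xs

withOthers : {A : Set} → List A → List (A × List A)
withOthers []       = []
withOthers (x ∷ xs) = (x , xs) ∷ map (λ { (y , ys) → (y , x ∷ ys) }) (withOthers xs)

module _ {V : Set} (T : Trigraph V) where

  isStable : List V → Bool
  isStable S = all (λ { (u , v) → not (isStrong (θ T u v)) }) (pairs S)

  -- weight of S: Σ_{v ∈ c(S)} w(v) + Σ_{uv ∈ σ(S)} w(uv)
  cWeight : List V → ℕ
  cWeight S = sum (map (λ { (v , os) →
      if all (λ o → isAnti (θ T v o)) os then w T v else 0 }) (withOthers S))

  σWeight : List V → ℕ
  σWeight S = sum (map (λ { (u , v) → if isSemi (θ T u v) then wp T u v else 0 }) (pairs S))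

  weight : List V → ℕ
  weight S = cWeight S + σWeight S

  -- α(T) = maximum weight of a stable set (∅ is stable of weight 0)
  α : ℕ
  α = foldr _⊔_ 0 (map (λ S → if isStable S then weight S else 0) (subsequences (verts T)))

count : {V : Set} → Trigraph V → (V → Bool) → ℕ
count T X = length (filterᵇ X (verts T))

StronglyComplete : {V : Set} → Trigraph V → V → (V → Bool) → Set
StronglyComplete T b X = ∀ a → a ∈ verts T → X a ≡ true → θ T b a ≡ strong

StronglyAnticomplete : {V : Set} → Trigraph V → V → (V → Bool) → Set
StronglyAnticomplete T b X = ∀ a → a ∈ verts T → X a ≡ true → θ T b a ≡ anti

record HomogeneousSet {V : Set} (T : Trigraph V) (X : V → Bool) : Set where
  field
    size-lo : 1 < count T X
    size-hi : count T X < length (verts T)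
    homog   : ∀ b → b ∈ verts T → X b ≡ false →
              StronglyComplete T b X ⊎ StronglyAnticomplete T b X

-- Homogeneous pairs. A split (A,B,C,D,E,F) is given as a labelling of
-- the vertices by the six parts (this forces the parts to partition V(T)).

data Part : Set where
  pA pB pC pD pE pF : Part

inA inB inC inD inE inF inAB inCDEF inCE inDE inDF inCF : Part → Bool
inA pA = true
inA _  = false
inB pB = true
inB _  = false
inC pC = true
inC _  = false
inD pD = true
inD _  = false
inE pE = true
inE _  = false
inF pF = true
inF _  = false
inAB p = inA p ∨ inB p
inCDEF p = not (inAB p)
inCE p = inC p ∨ inE p
inDE p = inD p ∨ inE p
inDF p = inD p ∨ inF p
inCF p = inC p ∨ inF p

_∘ₚ_ : {V : Set} → (Part → Bool) → (V → Part) → V → Bool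
(f ∘ₚ lab) v = f (lab v)

Nonempty : {V : Set} → Trigraph V → (V → Bool) → Set
Nonempty T X = ∃ λ v → v ∈ verts T × X v ≡ true

record HomogeneousPair {V : Set} (T : Trigraph V) (lab : V → Part) : Set where
  field
    A-ne   : Nonempty T (inA ∘ₚ lab)
    B-ne   : Nonempty T (inB ∘ₚ lab)
    A-CE   : ∀ a → a ∈ verts T → lab a ≡ pA → StronglyComplete T a (inCE ∘ₚ lab)
    A-DF   : ∀ a → a ∈ verts T → lab a ≡ pA → StronglyAnticomplete T a (inDF ∘ₚ lab)
    B-DE   : ∀ b → b ∈ verts T → lab b ≡ pB → StronglyComplete T b (inDE ∘ₚ lab)
    B-CF   : ∀ b → b ∈ verts T → lab b ≡ pB → StronglyAnticomplete T b (inCF ∘ₚ lab)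
    AB-notComplete     : ¬ (∀ a → a ∈ verts T → lab a ≡ pA → StronglyComplete T a (inB ∘ₚ lab))
    AB-notAnticomplete : ¬ (∀ a → a ∈ verts T → lab a ≡ pA → StronglyAnticomplete T a (inB ∘ₚ lab))
    AB-size   : 3 ≤ count T (inAB ∘ₚ lab)
    CDEF-size : 3 ≤ count T (inCDEF ∘ₚ lab)

Small : {V : Set} → Trigraph V → (V → Part) → Set
Small T lab = count T (inAB ∘ₚ lab) ≤ 6

Proper : {V : Set} → Trigraph V → (V → Part) → Set
Proper T lab = Nonempty T (inC ∘ₚ lab) × Nonempty T (inD ∘ₚ lab)

-- Decompositions (X,Y): X a homogeneous set, or X = A ∪ B for a small
-- or proper homogeneous pair (A,B); Y = V(T) ∖ X.

data Decomposition {V : Set} (T : Trigraph V) : Set where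
  hset  : (X : V → Bool) → HomogeneousSet T X → Decomposition T
  hpair : (lab : V → Part) → HomogeneousPair T lab →
          Small T lab ⊎ Proper T lab → Decomposition T

BlockV : {V : Set} {T : Trigraph V} → Decomposition T → Set
BlockV {V} (hset _ _)    = V
BlockV {V} (hpair _ _ _) = V ⊎ Bool   -- inj₂ true = a, inj₂ false = b

-- the choice needed to build the block: a vertex x ∈ X for a homogeneous set
BlockChoice : {V : Set} {T : Trigraph V} → Decomposition T → Set
BlockChoice {V} {T} (hset X _) = Σ V λ x → x ∈ verts T × X x ≡ true
BlockChoice (hpair _ _ _)      = ⊤

open import Data.Sum using (inj₁; inj₂)

block : {V : Set} → DecidableEquality V → (T : Trigraph V) →
        (d : Decomposition T) → BlockChoice d → Trigraph (BlockV d)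
block _≟_ T (hset X _) (x , _ , _) = record
  { verts = x ∷ filterᵇ (λ v → not (X v)) (verts T)
  ; θ     = θ T
  ; w     = λ v → case-x v
  ; wp    = wp T }
  where
  case-x : _ → ℕ
  case-x v with v ≟ x
  ... | yes _ = α (restrict T X)
  ... | no _  = w T v
block _≟_ T (hpair lab _ _) _ = record
  { verts = map inj₁ (filterᵇ (inCDEF ∘ₚ lab) (verts T)) ++ (inj₂ true ∷ inj₂ false ∷ [])
  ; θ     = θ'
  ; w     = w'
  ; wp    = wp' }
  where
  adjA adjB : _ → Adj
  adjA u = if inCE (lab u) then strong else anti
  adjB u = if inDE (lab u) then strong else anti
  θ' : _ → _ → Adj
  θ' (inj₁ u) (inj₁ v) = θ T u v
  θ' (inj₁ u) (inj₂ true)  = adjA u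
  θ' (inj₁ u) (inj₂ false) = adjB u
  θ' (inj₂ true)  (inj₁ u) = adjA u
  θ' (inj₂ false) (inj₁ u) = adjB u
  θ' (inj₂ true)  (inj₂ false) = semi
  θ' (inj₂ false) (inj₂ true)  = semi
  θ' (inj₂ _) (inj₂ _) = anti   -- diagonal, irrelevant
  w' : _ → ℕ
  w' (inj₁ u)      = w T u
  w' (inj₂ true)   = α (restrict T (inA ∘ₚ lab))
  w' (inj₂ false)  = α (restrict T (inB ∘ₚ lab))
  wp' : _ → _ → ℕ
  wp' (inj₁ u) (inj₁ v) = wp T u v
  wp' (inj₂ true)  (inj₂ false) = α (restrict T (inAB ∘ₚ lab))
  wp' (inj₂ false) (inj₂ true)  = α (restrict T (inAB ∘ₚ lab))
  wp' _ _ = 0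

module Submission where

-- Both inequalities are proved by domination: α(T) ≤ α(T') as soon as every
-- stable set of T is outweighed by some stable set of T' (dominates⇒α≤). For a homogeneous set X, a
-- stable set meeting X splits into a stable set of T[X] and a set strongly
-- anticomplete to X (HomogeneousSetCase); for a homogeneous pair (A,B), into
-- a stable set of T[A], T[B] or T[A ∪ B] and a set compatible with the
-- matching corner of the switchable pair ab (HomogeneousPairCase).

open import Defs
open import Data.Nat using (ℕ; _+_; _≤_; _⊔_)
open import Algebra.Bundles using (CommutativeMonoid)
import Algebra.Properties.CommutativeSemigroup as CommSemigroupProperties
open import Data.Nat.Properties using (module ≤-Reasoning; +-commutativeSemigroup; +-assoc; +-comm; +-identityʳ; ⊔-sel; m≤m⊔n; m≤n⊔m; ≤-trans; ≤-reflexive; +-monoˡ-≤; ≤-antisym)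
open import Data.Bool using (Bool; true; false; if_then_else_; _∧_; _∨_; not; T)
open import Data.Bool.Properties using (not-¬; ∨-zeroʳ; ∧-commutativeMonoid; ∧-assoc; ∧-identityʳ; T-≡)
open import Data.Bool.ListAction using (all; any)
open import Data.List using (List; []; _∷_; map; _++_; foldr; filterᵇ)
open import Data.List.Properties using (map-++; map-∘; map-id; filter-all)
open import Data.Nat.ListAction using (sum)
open import Data.Nat.ListAction.Properties using (sum-++; sum-↭)
open import Data.List.Membership.Propositional using (_∈_)
open import Data.List.Membership.Propositional.Properties using (∈-map⁺; ∈-map⁻; ∈-++⁺ˡ; ∈-++⁺ʳ; ∈-++⁻; ∈-filter⁻; foldr-selective)
open import Data.List.Relation.Unary.Any using (here; there)
open import Data.List.Relation.Unary.All as All using (All)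
open import Data.List.Relation.Binary.Sublist.Propositional using (_⊆_; []; _∷_; _∷ʳ_; ⊆-trans; lookup)
open import Data.List.Relation.Binary.Sublist.Propositional.Properties using (filter-⊆; filter⁺; []⊆-universal)
open import Data.List.Relation.Ternary.Interleaving.Propositional using (Interleaving; []; consˡ; consʳ; toPermutation)
import Data.List.Relation.Binary.Permutation.Propositional.Properties as Perm
import Data.List.Relation.Binary.Sublist.Propositional.Properties as Sublist
open import Data.Product using (Σ; _×_; _,_; proj₁; proj₂)
open import Data.Sum using (_⊎_; inj₁; inj₂)
open import Data.Empty using (⊥; ⊥-elim)
open import Data.Unit using (tt)
open import Function using (_∘_; Equivalence)
open import Relation.Nullary using (yes; no)
open import Relation.Nullary.Decidable using (T?)
open import Relation.Binary.PropositionalEquality using (_≡_; _≢_; refl; sym; trans; cong; cong₂; subst; module ≡-Reasoning)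
open import Relation.Binary.Definitions using (DecidableEquality)

open CommSemigroupProperties +-commutativeSemigroup using ()
  renaming (x∙yz≈y∙xz to +-exchange; interchange to +-interchange)
open CommSemigroupProperties (CommutativeMonoid.commutativeSemigroup ∧-commutativeMonoid) using ()
  renaming (x∙yz≈y∙xz to ∧-exchange)

private variable
  A B : Set

filterᵇ-⊆ : ∀ (p : A → Bool) xs → filterᵇ p xs ⊆ xs
filterᵇ-⊆ p = filter-⊆ (T? ∘ p)

filterᵇ-mono : ∀ (p : A → Bool) {S L} → S ⊆ L → filterᵇ p S ⊆ filterᵇ p L
filterᵇ-mono p = filter⁺ (T? ∘ p) (T? ∘ p) (λ { refl px → px })

∈-filterᵇ⁻ : ∀ (p : A → Bool) {xs x} → x ∈ filterᵇ p xs → p x ≡ true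
∈-filterᵇ⁻ p {xs} i = Equivalence.to T-≡ (proj₂ (∈-filter⁻ (T? ∘ p) {xs = xs} i))

⊆-filterᵇ : ∀ (p : A → Bool) {S L} → S ⊆ L → (∀ x → x ∈ S → p x ≡ true) → S ⊆ filterᵇ p L
⊆-filterᵇ p {S} {L} τ h = subst (_⊆ filterᵇ p L) (filter-all (T? ∘ p) allS) (filterᵇ-mono p τ)
  where
  allS : All (T ∘ p) S
  allS = All.tabulate (λ i → Equivalence.from T-≡ (h _ i))

interleave-filter : ∀ (p : A → Bool) S → Interleaving (filterᵇ p S) (filterᵇ (not ∘ p) S) S
interleave-filter p [] = []
interleave-filter p (x ∷ S) with p x
... | true  = consˡ (interleave-filter p S)
... | false = consʳ (interleave-filter p S)

interleave-++ : ∀ (xs ys : List A) → Interleaving xs ys (xs ++ ys)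
interleave-++ []       []       = []
interleave-++ []       (y ∷ ys) = consʳ (interleave-++ [] ys)
interleave-++ (x ∷ xs) ys       = consˡ (interleave-++ xs ys)

interleave-⊆ˡ : ∀ {S₁ S₂ S : List A} → Interleaving S₁ S₂ S → S₁ ⊆ S
interleave-⊆ˡ []         = []
interleave-⊆ˡ (consˡ sp) = refl ∷ interleave-⊆ˡ sp
interleave-⊆ˡ (consʳ sp) = _ ∷ʳ interleave-⊆ˡ sp

interleave-⊆ʳ : ∀ {S₁ S₂ S : List A} → Interleaving S₁ S₂ S → S₂ ⊆ S
interleave-⊆ʳ []         = []
interleave-⊆ʳ (consˡ sp) = _ ∷ʳ interleave-⊆ʳ sp
interleave-⊆ʳ (consʳ sp) = refl ∷ interleave-⊆ʳ sp

interleave-disjoint : ∀ {S₁ S₂ L : List A} → S₁ ⊆ L → S₂ ⊆ L → (∀ x → x ∈ S₁ → x ∈ S₂ → ⊥) →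
                      Σ (List A) λ S → S ⊆ L × Interleaving S₁ S₂ S
interleave-disjoint []         []         _ = [] , [] , []
interleave-disjoint (y ∷ʳ τ₁)  (.y ∷ʳ τ₂) d with interleave-disjoint τ₁ τ₂ d
... | S , τ , sp = S , y ∷ʳ τ , sp
interleave-disjoint (y ∷ʳ τ₁)  (refl ∷ τ₂) d with interleave-disjoint τ₁ τ₂ (λ x i j → d x i (there j))
... | S , τ , sp = y ∷ S , refl ∷ τ , consʳ sp
interleave-disjoint (refl ∷ τ₁) (y ∷ʳ τ₂) d with interleave-disjoint τ₁ τ₂ (λ x i j → d x (there i) j)
... | S , τ , sp = y ∷ S , refl ∷ τ , consˡ sp
interleave-disjoint (refl ∷ τ₁) (refl ∷ τ₂) d = ⊥-elim (d _ (here refl) (here refl))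

⊆-++-split : ∀ (L₁ L₂ : List A) {S} → S ⊆ L₁ ++ L₂ →
             Σ (List A) λ S₁ → Σ (List A) λ S₂ → S ≡ S₁ ++ S₂ × S₁ ⊆ L₁ × S₂ ⊆ L₂
⊆-++-split []       L₂ {S} τ = [] , S , refl , [] , τ
⊆-++-split (x ∷ L₁) L₂ (.x ∷ʳ τ) with ⊆-++-split L₁ L₂ τ
... | S₁ , S₂ , refl , τ₁ , τ₂ = S₁ , S₂ , refl , x ∷ʳ τ₁ , τ₂
⊆-++-split (x ∷ L₁) L₂ (refl ∷ τ) with ⊆-++-split L₁ L₂ τ
... | S₁ , S₂ , refl , τ₁ , τ₂ = x ∷ S₁ , S₂ , refl , refl ∷ τ₁ , τ₂

⊆-map-split : ∀ (f : A → B) (L : List A) {S} → S ⊆ map f L → Σ (List A) λ S₀ → S ≡ map f S₀ × S₀ ⊆ L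
⊆-map-split f []      []              = [] , refl , []
⊆-map-split f (x ∷ L) (.(f x) ∷ʳ τ) with ⊆-map-split f L τ
... | S₀ , refl , τ₀ = S₀ , refl , x ∷ʳ τ₀
⊆-map-split f (x ∷ L) (refl ∷ τ) with ⊆-map-split f L τ
... | S₀ , refl , τ₀ = x ∷ S₀ , refl , refl ∷ τ₀

∧-true⁻ : ∀ {a b} → (a ∧ b) ≡ true → a ≡ true × b ≡ true
∧-true⁻ {true} e = refl , e

all-++ : ∀ (q : A → Bool) xs ys → all q (xs ++ ys) ≡ (all q xs ∧ all q ys)
all-++ q []       ys = refl
all-++ q (x ∷ xs) ys = trans (cong (q x ∧_) (all-++ q xs ys)) (sym (∧-assoc (q x) (all q xs) (all q ys)))

all-map : ∀ (q : B → Bool) (f : A → B) xs → all q (map f xs) ≡ all (q ∘ f) xs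
all-map q f []       = refl
all-map q f (x ∷ xs) = cong (q (f x) ∧_) (all-map q f xs)

all-interleave : ∀ (q : A → Bool) {S₁ S₂ S} → Interleaving S₁ S₂ S → all q S ≡ (all q S₁ ∧ all q S₂)
all-interleave q []                            = refl
all-interleave q {x ∷ S₁} {S₂} (consˡ sp) =
  trans (cong (q x ∧_) (all-interleave q sp)) (sym (∧-assoc (q x) (all q S₁) (all q S₂)))
all-interleave q {S₁} {x ∷ S₂} (consʳ sp) =
  trans (cong (q x ∧_) (all-interleave q sp)) (∧-exchange (q x) (all q S₁) (all q S₂))

all-cong : ∀ (q r : A → Bool) xs → (∀ v → v ∈ xs → q v ≡ r v) → all q xs ≡ all r xs
all-cong q r []       h = refl
all-cong q r (x ∷ xs) h = cong₂ _∧_ (h x (here refl)) (all-cong q r xs (λ v i → h v (there i)))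

all-true : ∀ (q : A → Bool) xs → (∀ v → v ∈ xs → q v ≡ true) → all q xs ≡ true
all-true q xs h = trans (all-cong q (λ _ → true) xs h) (all-const xs)
  where
  all-const : ∀ (xs : List A) → all (λ _ → true) xs ≡ true
  all-const []       = refl
  all-const (_ ∷ xs) = all-const xs

all-∈ : ∀ (q : A → Bool) {xs v} → all q xs ≡ true → v ∈ xs → q v ≡ true
all-∈ q {x ∷ xs} e (here refl) = proj₁ (∧-true⁻ e)
all-∈ q {x ∷ xs} e (there i)   = all-∈ q (proj₂ (∧-true⁻ {q x} e)) i

all-⊆ : ∀ (q : A → Bool) {S₁ S} → S₁ ⊆ S → all q S ≡ true → all q S₁ ≡ true
all-⊆ q τ e = all-true q _ (λ v i → all-∈ q e (lookup τ i))

any-∈ : ∀ (q : A → Bool) {xs v} → v ∈ xs → q v ≡ true → any q xs ≡ true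
any-∈ q {x ∷ xs} (here refl) e rewrite e = refl
any-∈ q {x ∷ xs} (there i)   e with q x
... | true  = refl
... | false = any-∈ q i e

any-true⁻ : ∀ (q : A → Bool) xs → any q xs ≡ true → Σ A λ v → v ∈ xs × q v ≡ true
any-true⁻ q (x ∷ xs) e with q x in qx
... | true  = x , here refl , qx
... | false with any-true⁻ q xs e
...   | v , i , qv = v , there i , qv

sum-interleave : ∀ (f : A → ℕ) {S₁ S₂ S} → Interleaving S₁ S₂ S →
                 sum (map f S) ≡ sum (map f S₁) + sum (map f S₂)
sum-interleave f {S₁} {S₂} {S} sp = begin
  sum (map f S)                     ≡⟨ sum-↭ (Perm.map⁺ f (toPermutation sp)) ⟩
  sum (map f (S₁ ++ S₂))            ≡⟨ cong sum (map-++ f S₁ S₂) ⟩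
  sum (map f S₁ ++ map f S₂)        ≡⟨ sum-++ (map f S₁) (map f S₂) ⟩
  sum (map f S₁) + sum (map f S₂)   ∎
  where open ≡-Reasoning

sum-cong : ∀ (f g : A → ℕ) xs → (∀ v → v ∈ xs → f v ≡ g v) → sum (map f xs) ≡ sum (map g xs)
sum-cong f g []       h = refl
sum-cong f g (x ∷ xs) h = cong₂ _+_ (h x (here refl)) (sum-cong f g xs (λ v i → h v (there i)))

sum-zero : ∀ (f : A → ℕ) xs → (∀ v → v ∈ xs → f v ≡ 0) → sum (map f xs) ≡ 0
sum-zero f []       h = refl
sum-zero f (x ∷ xs) h rewrite h x (here refl) = sum-zero f xs (λ v i → h v (there i))

sum-map-++ : ∀ (f : A → ℕ) xs ys → sum (map f (xs ++ ys)) ≡ sum (map f xs) + sum (map f ys)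
sum-map-++ f xs ys = trans (cong sum (map-++ f xs ys)) (sum-++ (map f xs) (map f ys))

sum-map-∘ : ∀ (f : B → ℕ) (g : A → B) xs → sum (map f (map g xs)) ≡ sum (map (f ∘ g) xs)
sum-map-∘ f g xs = cong sum (sym (map-∘ xs))

-- The definitions of stability
-- and weight go through the auxiliary lists 'pairs' and 'withOthers'; they
-- are replaced here by equivalent definitions by recursion on the list,
-- which behave well under interleavings and sublists.
module StableSets {V : Set} (T : Trigraph V) where

  nonStrong strongAnti : V → V → Bool
  nonStrong u v  = not (isStrong (θ T u v))
  strongAnti u v = isAnti (θ T u v)

  pairWeight : V → V → ℕ
  pairWeight u v = if isSemi (θ T u v) then wp T u v else 0

  stable : List V → Bool
  stable []       = true
  stable (x ∷ xs) = all (nonStrong x) xs ∧ stable xs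

  σW : List V → ℕ
  σW []       = 0
  σW (x ∷ xs) = sum (map (pairWeight x) xs) + σW xs

  -- the c(S)-part of the weight, counting only vertices satisfying p;
  -- passing x, the filter p records "strongly antiadjacent to x"
  cW : (V → Bool) → List V → ℕ
  cW p []       = 0
  cW p (x ∷ xs) = (if p x ∧ all (strongAnti x) xs then w T x else 0) + cW (λ v → p v ∧ strongAnti v x) xs

  isStable≡stable : ∀ S → isStable T S ≡ stable S
  isStable≡stable []       = refl
  isStable≡stable (x ∷ xs) = trans (all-++ _ (map (x ,_) xs) (pairs xs))
    (cong₂ _∧_ (all-map _ (x ,_) xs) (isStable≡stable xs))

  σWeight≡σW : ∀ S → σWeight T S ≡ σW S
  σWeight≡σW []       = refl
  σWeight≡σW (x ∷ xs) = trans (sum-map-++ _ (map (x ,_) xs) (pairs xs))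
    (cong₂ _+_ (sum-map-∘ _ (x ,_) xs) (σWeight≡σW xs))

  private
    core : (V → Bool) → V × List V → ℕ
    core p (v , os) = if p v ∧ all (strongAnti v) os then w T v else 0

    core-sum≡cW : ∀ p S → sum (map (core p) (withOthers S)) ≡ cW p S
    core-sum≡cW p []       = refl
    core-sum≡cW p (x ∷ xs) = cong (core p (x , xs) +_) (begin
      sum (map (core p) (map (λ { (y , ys) → (y , x ∷ ys) }) (withOthers xs)))
        ≡⟨ sum-map-∘ (core p) _ (withOthers xs) ⟩
      sum (map (λ { (v , os) → core p (v , x ∷ os) }) (withOthers xs))
        ≡⟨ sum-cong _ (core p') (withOthers xs) (λ { (v , os) _ →
             cong (λ b → if b then w T v else 0) (sym (∧-assoc (p v) (strongAnti v x) (all (strongAnti v) os))) }) ⟩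
      sum (map (core p') (withOthers xs))
        ≡⟨ core-sum≡cW p' xs ⟩
      cW p' xs ∎)
      where
      open ≡-Reasoning
      p' = λ v → p v ∧ strongAnti v x

  weight≡ : ∀ S → weight T S ≡ cW (λ _ → true) S + σW S
  weight≡ S = cong₂ _+_ (core-sum≡cW (λ _ → true) S) (σWeight≡σW S)

  Anticomplete : List V → List V → Set
  Anticomplete S₁ S₂ = ∀ u v → u ∈ S₁ → v ∈ S₂ → θ T u v ≡ anti × θ T v u ≡ anti

  private
    anticomplete-∷ˡ : ∀ {x S₁ S₂} → Anticomplete (x ∷ S₁) S₂ → Anticomplete S₁ S₂
    anticomplete-∷ˡ h u v i j = h u v (there i) j

    anticomplete-∷ʳ : ∀ {x S₁ S₂} → Anticomplete S₁ (x ∷ S₂) → Anticomplete S₁ S₂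
    anticomplete-∷ʳ h u v i j = h u v i (there j)

    all-anti : ∀ (q : V → V → Bool) → (∀ {u v} → θ T u v ≡ anti → q u v ≡ true) →
               ∀ x xs → (∀ v → v ∈ xs → θ T x v ≡ anti) → all (q x) xs ≡ true
    all-anti q q-anti x xs h = all-true (q x) xs (λ v i → q-anti (h v i))

    strongAnti-anti : ∀ {u v} → θ T u v ≡ anti → strongAnti u v ≡ true
    strongAnti-anti e rewrite e = refl

    nonStrong-anti : ∀ {u v} → θ T u v ≡ anti → nonStrong u v ≡ true
    nonStrong-anti e rewrite e = refl

    pairWeight-anti : ∀ {u v} → θ T u v ≡ anti → pairWeight u v ≡ 0
    pairWeight-anti e rewrite e = refl

    cW-cong : ∀ p q S → (∀ v → v ∈ S → p v ≡ q v) → cW p S ≡ cW q S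
    cW-cong p q []       h = refl
    cW-cong p q (x ∷ xs) h = cong₂ _+_
      (cong (λ b → if b ∧ all (strongAnti x) xs then w T x else 0) (h x (here refl)))
      (cW-cong _ _ xs (λ v i → cong (_∧ strongAnti v x) (h v (there i))))

    cW-drop : ∀ p x S → (∀ v → v ∈ S → θ T v x ≡ anti) → cW (λ v → p v ∧ strongAnti v x) S ≡ cW p S
    cW-drop p x S h = cW-cong _ _ S (λ v i → trans (cong (p v ∧_) (strongAnti-anti (h v i))) (∧-identityʳ (p v)))

    cW-interleave : ∀ p {S₁ S₂ S} → Interleaving S₁ S₂ S → Anticomplete S₁ S₂ → cW p S ≡ cW p S₁ + cW p S₂
    cW-interleave p [] h = refl
    cW-interleave p {x ∷ S₁} {S₂} {x ∷ S} (consˡ sp) h = begin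
      head (all (strongAnti x) S) + cW p' S             ≡⟨ cong₂ _+_ (cong head all-S) (cW-interleave p' sp (anticomplete-∷ˡ h)) ⟩
      head (all (strongAnti x) S₁) + (cW p' S₁ + cW p' S₂) ≡⟨ cong (λ n → head (all (strongAnti x) S₁) + (cW p' S₁ + n)) drop-S₂ ⟩
      head (all (strongAnti x) S₁) + (cW p' S₁ + cW p S₂)  ≡⟨ sym (+-assoc (head (all (strongAnti x) S₁)) (cW p' S₁) (cW p S₂)) ⟩
      head (all (strongAnti x) S₁) + cW p' S₁ + cW p S₂    ∎
      where
      open ≡-Reasoning
      p' = λ v → p v ∧ strongAnti v x
      head = λ b → if p x ∧ b then w T x else 0
      all-S : all (strongAnti x) S ≡ all (strongAnti x) S₁
      all-S = trans (all-interleave (strongAnti x) sp) (trans (cong (all (strongAnti x) S₁ ∧_)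
                (all-anti strongAnti strongAnti-anti x S₂ (λ v j → proj₁ (h x v (here refl) j))))
                (∧-identityʳ _))
      drop-S₂ : cW p' S₂ ≡ cW p S₂
      drop-S₂ = cW-drop p x S₂ (λ v j → proj₂ (h x v (here refl) j))
    cW-interleave p {S₁} {x ∷ S₂} {x ∷ S} (consʳ sp) h = begin
      head (all (strongAnti x) S) + cW p' S             ≡⟨ cong₂ _+_ (cong head all-S) (cW-interleave p' sp (anticomplete-∷ʳ h)) ⟩
      head (all (strongAnti x) S₂) + (cW p' S₁ + cW p' S₂) ≡⟨ cong (λ n → head (all (strongAnti x) S₂) + (n + cW p' S₂)) drop-S₁ ⟩
      head (all (strongAnti x) S₂) + (cW p S₁ + cW p' S₂)  ≡⟨ +-exchange (head (all (strongAnti x) S₂)) (cW p S₁) (cW p' S₂) ⟩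
      cW p S₁ + (head (all (strongAnti x) S₂) + cW p' S₂)  ∎
      where
      open ≡-Reasoning
      p' = λ v → p v ∧ strongAnti v x
      head = λ b → if p x ∧ b then w T x else 0
      all-S : all (strongAnti x) S ≡ all (strongAnti x) S₂
      all-S = trans (all-interleave (strongAnti x) sp) (cong (_∧ all (strongAnti x) S₂)
                (all-anti strongAnti strongAnti-anti x S₁ (λ v j → proj₂ (h v x j (here refl)))))
      drop-S₁ : cW p' S₁ ≡ cW p S₁
      drop-S₁ = cW-drop p x S₁ (λ v j → proj₁ (h v x j (here refl)))

    σW-interleave : ∀ {S₁ S₂ S} → Interleaving S₁ S₂ S → Anticomplete S₁ S₂ → σW S ≡ σW S₁ + σW S₂
    σW-interleave [] h = refl
    σW-interleave {x ∷ S₁} {S₂} {x ∷ S} (consˡ sp) h =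
      trans (cong₂ _+_ row (σW-interleave sp (anticomplete-∷ˡ h))) (sym (+-assoc (sum (map (pairWeight x) S₁)) (σW S₁) (σW S₂)))
      where
      row : sum (map (pairWeight x) S) ≡ sum (map (pairWeight x) S₁)
      row = trans (sum-interleave (pairWeight x) sp) (trans (cong (sum (map (pairWeight x) S₁) +_)
              (sum-zero (pairWeight x) S₂ (λ v j → pairWeight-anti (proj₁ (h x v (here refl) j))))) (+-identityʳ _))
    σW-interleave {S₁} {x ∷ S₂} {x ∷ S} (consʳ sp) h =
      trans (cong₂ _+_ row (σW-interleave sp (anticomplete-∷ʳ h))) (+-exchange (sum (map (pairWeight x) S₂)) (σW S₁) (σW S₂))
      where
      row : sum (map (pairWeight x) S) ≡ sum (map (pairWeight x) S₂)
      row = trans (sum-interleave (pairWeight x) sp) (cong (_+ sum (map (pairWeight x) S₂))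
              (sum-zero (pairWeight x) S₁ (λ v j → pairWeight-anti (proj₂ (h v x j (here refl))))))

    stable-interleave : ∀ {S₁ S₂ S} → Interleaving S₁ S₂ S → Anticomplete S₁ S₂ → stable S ≡ (stable S₁ ∧ stable S₂)
    stable-interleave [] h = refl
    stable-interleave {x ∷ S₁} {S₂} {x ∷ S} (consˡ sp) h =
      trans (cong₂ _∧_ row (stable-interleave sp (anticomplete-∷ˡ h))) (sym (∧-assoc (all (nonStrong x) S₁) (stable S₁) (stable S₂)))
      where
      row : all (nonStrong x) S ≡ all (nonStrong x) S₁
      row = trans (all-interleave (nonStrong x) sp) (trans (cong (all (nonStrong x) S₁ ∧_)
              (all-anti nonStrong nonStrong-anti x S₂ (λ v j → proj₁ (h x v (here refl) j)))) (∧-identityʳ _))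
    stable-interleave {S₁} {x ∷ S₂} {x ∷ S} (consʳ sp) h =
      trans (cong₂ _∧_ row (stable-interleave sp (anticomplete-∷ʳ h))) (∧-exchange (all (nonStrong x) S₂) (stable S₁) (stable S₂))
      where
      row : all (nonStrong x) S ≡ all (nonStrong x) S₂
      row = trans (all-interleave (nonStrong x) sp) (cong (_∧ all (nonStrong x) S₂)
              (all-anti nonStrong nonStrong-anti x S₁ (λ v j → proj₂ (h v x j (here refl)))))

  isStable-interleave : ∀ {S₁ S₂ S} → Interleaving S₁ S₂ S → Anticomplete S₁ S₂ →
                        isStable T S ≡ (isStable T S₁ ∧ isStable T S₂)
  isStable-interleave {S₁} {S₂} {S} sp h = trans (isStable≡stable S) (trans (stable-interleave sp h)
    (sym (cong₂ _∧_ (isStable≡stable S₁) (isStable≡stable S₂))))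

  weight-interleave : ∀ {S₁ S₂ S} → Interleaving S₁ S₂ S → Anticomplete S₁ S₂ →
                      weight T S ≡ weight T S₁ + weight T S₂
  weight-interleave {S₁} {S₂} {S} sp h = begin
    weight T S                                        ≡⟨ weight≡ S ⟩
    cW all₁ S + σW S                                  ≡⟨ cong₂ _+_ (cW-interleave all₁ sp h) (σW-interleave sp h) ⟩
    (cW all₁ S₁ + cW all₁ S₂) + (σW S₁ + σW S₂)       ≡⟨ +-interchange (cW all₁ S₁) (cW all₁ S₂) (σW S₁) (σW S₂) ⟩
    (cW all₁ S₁ + σW S₁) + (cW all₁ S₂ + σW S₂)       ≡⟨ sym (cong₂ _+_ (weight≡ S₁) (weight≡ S₂)) ⟩
    weight T S₁ + weight T S₂                         ∎
    where
    open ≡-Reasoning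
    all₁ = λ (_ : V) → true

  isStable-⊆ : ∀ {S₁ S} → S₁ ⊆ S → isStable T S ≡ true → isStable T S₁ ≡ true
  isStable-⊆ {S₁} {S} τ e = trans (isStable≡stable S₁) (stable-⊆ τ (trans (sym (isStable≡stable S)) e))
    where
    stable-⊆ : ∀ {S₁ S} → S₁ ⊆ S → stable S ≡ true → stable S₁ ≡ true
    stable-⊆ []         e = refl
    stable-⊆ {S = y ∷ S} (.y ∷ʳ τ) e = stable-⊆ τ (proj₂ (∧-true⁻ {all (nonStrong y) S} e))
    stable-⊆ (refl ∷ τ) e with ∧-true⁻ e
    ... | row , rest = cong₂ _∧_ (all-⊆ _ τ row) (stable-⊆ τ rest)

  isStable-noStrong : ∀ {S u v} → isStable T S ≡ true → u ∈ S → v ∈ S → u ≢ v →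
                      θ T u v ≡ strong → θ T v u ≡ strong → ⊥
  isStable-noStrong {S} e = go (trans (sym (isStable≡stable S)) e)
    where
    strong-nonStrong : ∀ {u v} → θ T u v ≡ strong → nonStrong u v ≡ true → ⊥
    strong-nonStrong s n = not-¬ (sym (cong isStrong s)) (sym n)
    go : ∀ {S u v} → stable S ≡ true → u ∈ S → v ∈ S → u ≢ v → θ T u v ≡ strong → θ T v u ≡ strong → ⊥
    go {x ∷ S} e (here refl) (here refl) d _ _ = d refl
    go {x ∷ S} e (here refl) (there j)   d s _ = strong-nonStrong s (all-∈ (nonStrong x) (proj₁ (∧-true⁻ e)) j)
    go {x ∷ S} e (there i)   (here refl) d _ s = strong-nonStrong s (all-∈ (nonStrong x) (proj₁ (∧-true⁻ e)) i)
    go {x ∷ S} e (there i)   (there j)   d s s' = go (proj₂ (∧-true⁻ {all (nonStrong x) S} e)) i j d s s'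

module Embedding {V V' : Set} (T : Trigraph V) (T' : Trigraph V') (f : V → V') where
  private
    module S  = StableSets T
    module S' = StableSets T'

  record Faithful (S : List V) : Set where
    field
      θ-pres  : ∀ u v → u ∈ S → v ∈ S → θ T' (f u) (f v) ≡ θ T u v
      w-pres  : ∀ u → u ∈ S → w T' (f u) ≡ w T u
      wp-pres : ∀ u v → u ∈ S → v ∈ S → wp T' (f u) (f v) ≡ wp T u v
  open Faithful

  private
    faithful-tail : ∀ {x S} → Faithful (x ∷ S) → Faithful S
    faithful-tail F = record
      { θ-pres  = λ u v i j → θ-pres F u v (there i) (there j)
      ; w-pres  = λ u i → w-pres F u (there i)
      ; wp-pres = λ u v i j → wp-pres F u v (there i) (there j) }

    stable-map : ∀ S → Faithful S → S'.stable (map f S) ≡ S.stable S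
    stable-map []      F = refl
    stable-map (x ∷ S) F = cong₂ _∧_
      (trans (all-map (S'.nonStrong (f x)) f S)
             (all-cong _ _ S (λ v i → cong (not ∘ isStrong) (θ-pres F x v (here refl) (there i)))))
      (stable-map S (faithful-tail F))

    σW-map : ∀ S → Faithful S → S'.σW (map f S) ≡ S.σW S
    σW-map []      F = refl
    σW-map (x ∷ S) F = cong₂ _+_
      (trans (sum-map-∘ (S'.pairWeight (f x)) f S) (sum-cong _ _ S pairWeight-pres))
      (σW-map S (faithful-tail F))
      where
      pairWeight-pres : ∀ v → v ∈ S → S'.pairWeight (f x) (f v) ≡ S.pairWeight x v
      pairWeight-pres v i = cong₂ (λ a n → if isSemi a then n else 0)
        (θ-pres F x v (here refl) (there i)) (wp-pres F x v (here refl) (there i))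

    cW-map : ∀ p p' S → Faithful S → (∀ v → v ∈ S → p' (f v) ≡ p v) → S'.cW p' (map f S) ≡ S.cW p S
    cW-map p p' []      F hp = refl
    cW-map p p' (x ∷ S) F hp = cong₂ _+_
      (cong₂ (λ b n → if b then n else 0)
        (cong₂ _∧_ (hp x (here refl)) (trans (all-map (S'.strongAnti (f x)) f S)
           (all-cong _ _ S (λ v i → cong isAnti (θ-pres F x v (here refl) (there i))))))
        (w-pres F x (here refl)))
      (cW-map _ _ S (faithful-tail F)
        (λ v i → cong₂ _∧_ (hp v (there i)) (cong isAnti (θ-pres F v x (there i) (here refl)))))

  isStable-map : ∀ S → Faithful S → isStable T' (map f S) ≡ isStable T S
  isStable-map S F = trans (S'.isStable≡stable (map f S)) (trans (stable-map S F) (sym (S.isStable≡stable S)))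

  weight-map : ∀ S → Faithful S → weight T' (map f S) ≡ weight T S
  weight-map S F = trans (S'.weight≡ (map f S))
    (trans (cong₂ _+_ (cW-map _ _ S F (λ _ _ → refl)) (σW-map S F)) (sym (S.weight≡ S)))

-- α as a maximum: the subsequences of L are exactly its sublists, so α(T)
-- bounds the weight of every stable set of T and is attained by one.
⊆⇒∈subsequences : ∀ {S L : List A} → S ⊆ L → S ∈ subsequences L
⊆⇒∈subsequences []                   = here refl
⊆⇒∈subsequences {L = x ∷ L} (.x ∷ʳ τ) = ∈-++⁺ʳ (map (x ∷_) (subsequences L)) (⊆⇒∈subsequences τ)
⊆⇒∈subsequences (refl ∷ τ)           = ∈-++⁺ˡ (∈-map⁺ (_ ∷_) (⊆⇒∈subsequences τ))

∈subsequences⇒⊆ : ∀ {S : List A} L → S ∈ subsequences L → S ⊆ L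
∈subsequences⇒⊆ []      (here refl) = []
∈subsequences⇒⊆ (x ∷ L) i with ∈-++⁻ (map (x ∷_) (subsequences L)) i
... | inj₁ j with ∈-map⁻ (x ∷_) j
...   | S , k , refl = refl ∷ ∈subsequences⇒⊆ L k
∈subsequences⇒⊆ (x ∷ L) i | inj₂ j = x ∷ʳ ∈subsequences⇒⊆ L j

≤-foldr-⊔ : ∀ {n ns} → n ∈ ns → n ≤ foldr _⊔_ 0 ns
≤-foldr-⊔ {ns = m ∷ ns} (here refl) = m≤m⊔n m _
≤-foldr-⊔ {ns = m ∷ ns} (there i)   = ≤-trans (≤-foldr-⊔ i) (m≤n⊔m m _)

module _ {V : Set} (T : Trigraph V) where
  private
    value : List V → ℕ
    value S = if isStable T S then weight T S else 0

  α-upper : ∀ S → S ⊆ verts T → isStable T S ≡ true → weight T S ≤ α T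
  α-upper S τ st = subst (_≤ α T) (cong (λ b → if b then weight T S else 0) st)
    (≤-foldr-⊔ (∈-map⁺ value (⊆⇒∈subsequences τ)))

  α-attained : Σ (List V) λ S → S ⊆ verts T × isStable T S ≡ true × weight T S ≡ α T
  α-attained with foldr-selective ⊔-sel 0 (map value (subsequences (verts T)))
  ... | inj₁ α≡0 = [] , []⊆-universal _ , refl , sym α≡0
  ... | inj₂ i with ∈-map⁻ value i
  ...   | S , j , α≡value with isStable T S in st
  ...     | true  = S , ∈subsequences⇒⊆ (verts T) j , st , sym α≡value
  ...     | false = [] , []⊆-universal _ , refl , sym α≡value

α-restrict-none : {V : Set} (T : Trigraph V) → α (restrict T (λ _ → false)) ≡ 0
α-restrict-none T with α-attained (restrict T (λ _ → false))
... | S , τ , _ , wS≡α = trans (sym wS≡α) (cong (weight T) (⊆-none (verts T) τ))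
  where
  ⊆-none : ∀ {S} L → S ⊆ filterᵇ (λ _ → false) L → S ≡ []
  ⊆-none []      [] = refl
  ⊆-none (x ∷ L) τ  = ⊆-none L τ

Dominates : {V V' : Set} → Trigraph V' → Trigraph V → Set
Dominates {V} {V'} T' T = ∀ S → S ⊆ verts T → isStable T S ≡ true →
  Σ (List V') λ S' → S' ⊆ verts T' × isStable T' S' ≡ true × weight T S ≤ weight T' S'

dominates⇒α≤ : {V V' : Set} (T : Trigraph V) (T' : Trigraph V') → Dominates T' T → α T ≤ α T'
dominates⇒α≤ T T' dom with α-attained T
... | S , τ , st , wS≡α with dom S τ st
...   | S' , τ' , st' , wS≤wS' = ≤-trans (≤-reflexive (sym wS≡α)) (≤-trans wS≤wS' (α-upper T' S' τ' st'))

Within : {V : Set} → Trigraph V → (V → Bool) → List V → Set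
Within T P S = ∀ v → v ∈ S → v ∈ verts T × P v ≡ true

within-filter : {V : Set} (T : Trigraph V) (P : V → Bool) {S : List V} → S ⊆ filterᵇ P (verts T) → Within T P S
within-filter T P τ v i = proj₁ (∈-filter⁻ (T? ∘ P) {xs = verts T} (lookup τ i)) , ∈-filterᵇ⁻ P {verts T} (lookup τ i)

-- Homogeneity makes every vertex outside X that can share a stable set with
-- a member of X strongly anticomplete to X; hence a stable set of T splits
-- into a stable set of T[X] (weighing at most α(T[X])) glued to a stable set
-- outside X, and conversely x can be expanded into an optimal set of T[X].
module HomogeneousSetCase {V : Set} (_≟_ : DecidableEquality V) (T : Trigraph V) (W : Weighted T)
    (X : V → Bool) (H : HomogeneousSet T X) (x : V) (x∈T : x ∈ verts T) (xX : X x ≡ true) where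

  T' : Trigraph V
  T' = block _≟_ T (hset X H) (x , x∈T , xX)

  Y : V → Bool
  Y v = not (X v)

  open StableSets T using (Anticomplete; isStable-interleave; weight-interleave; isStable-⊆; isStable-noStrong)
  open StableSets T' using ()
    renaming (isStable-interleave to isStable-interleave'; weight-interleave to weight-interleave'; isStable-noStrong to isStable-noStrong')

  θ-sym : ∀ u v → u ∈ verts T → v ∈ verts T → θ T u v ≡ θ T v u
  θ-sym = WellFormed.θ-sym (Weighted.wf W)

  within-Y : ∀ {S₂} → S₂ ⊆ filterᵇ Y (verts T) → Within T Y S₂
  within-Y = within-filter T Y

  not-X : ∀ {v} → Y v ≡ true → X v ≡ false
  not-X {v} e with X v
  ... | false = refl

  w-x : w T' x ≡ α (restrict T X)
  w-x with x ≟ x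
  ... | yes _  = refl
  ... | no x≢x = ⊥-elim (x≢x refl)

  w-Y : ∀ v → X v ≡ false → w T' v ≡ w T v
  w-Y v vY with v ≟ x
  ... | yes refl = ⊥-elim (not-¬ xX vY)
  ... | no _     = refl

  same-outside : ∀ {S₂} → S₂ ⊆ filterᵇ Y (verts T) → isStable T' S₂ ≡ isStable T S₂ × weight T' S₂ ≡ weight T S₂
  same-outside {S₂} τ₂ = subst (λ S → isStable T' S ≡ isStable T S₂) (map-id S₂) (isStable-map S₂ faithful)
                       , subst (λ S → weight T' S ≡ weight T S₂) (map-id S₂) (weight-map S₂ faithful)
    where
    open Embedding T T' (λ v → v)
    faithful : Faithful S₂
    faithful = record
      { θ-pres  = λ _ _ _ _ → refl
      ; w-pres  = λ v i → w-Y v (not-X (proj₂ (within-Y τ₂ v i)))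
      ; wp-pres = λ _ _ _ _ → refl }

  anticomplete-to-X : ∀ {u v} → u ∈ verts T → X u ≡ true → v ∈ verts T → X v ≡ false →
                      (θ T u v ≡ strong → θ T v u ≡ strong → ⊥) → StronglyAnticomplete T v X
  anticomplete-to-X {u} {v} u∈T uX v∈T vX not-strong with HomogeneousSet.homog H v v∈T vX
  ... | inj₂ anticomplete = anticomplete
  ... | inj₁ complete = ⊥-elim (not-strong (trans (θ-sym u v u∈T v∈T) vu-strong) vu-strong)
    where vu-strong = complete u u∈T uX

  anticomplete-X-Y : ∀ {S₁ S₂} → Within T X S₁ → Within T Y S₂ →
                     (∀ v → v ∈ S₂ → StronglyAnticomplete T v X) → Anticomplete S₁ S₂
  anticomplete-X-Y S₁X S₂Y h u v i j = trans (θ-sym u v (proj₁ (S₁X u i)) (proj₁ (S₂Y v j))) vu-anti , vu-anti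
    where vu-anti = h v j u (proj₁ (S₁X u i)) (proj₂ (S₁X u i))

  add-x : ∀ {S₂} → Within T Y S₂ → (∀ v → v ∈ S₂ → StronglyAnticomplete T v X) →
          isStable T' (x ∷ S₂) ≡ isStable T' S₂ × weight T' (x ∷ S₂) ≡ α (restrict T X) + weight T' S₂
  add-x {S₂} S₂Y h = isStable-interleave' (interleave-++ (x ∷ []) S₂) x-S₂
                   , trans (weight-interleave' (interleave-++ (x ∷ []) S₂) x-S₂)
                       (cong (_+ weight T' S₂) (trans (+-identityʳ _) (trans (+-identityʳ _) w-x)))
    where
    x-S₂ : Anticomplete (x ∷ []) S₂
    x-S₂ = anticomplete-X-Y (λ { _ (here refl) → x∈T , xX }) S₂Y h

  up : Dominates T' T
  up S τ st = split (filterᵇ X S) (filterᵇ Y S) (interleave-filter X S) (filterᵇ-mono X τ) (filterᵇ-mono Y τ)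
    where
    split : ∀ S₁ S₂ → Interleaving S₁ S₂ S → S₁ ⊆ filterᵇ X (verts T) → S₂ ⊆ filterᵇ Y (verts T) →
            Σ (List V) λ S' → S' ⊆ verts T' × isStable T' S' ≡ true × weight T S ≤ weight T' S'
    -- S misses X: it is a stable set of T' as it stands
    split [] S₂ sp τ₁ τ₂ =
      S₂ , x ∷ʳ τ₂ , trans (proj₁ (same-outside τ₂)) (isStable-⊆ (interleave-⊆ʳ sp) st) ,
      ≤-reflexive (trans (weight-interleave sp (λ _ _ ())) (sym (proj₂ (same-outside τ₂))))
    -- S meets X in s: replace S ∩ X by x
    split (s ∷ S₁) S₂ sp τ₁ τ₂ = x ∷ S₂ , refl ∷ τ₂ , stable , weight-≤
      where
      S₁X = within-filter T X τ₁
      S₂Y = within-Y τ₂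
      anticomplete : ∀ v → v ∈ S₂ → StronglyAnticomplete T v X
      anticomplete v j = anticomplete-to-X (proj₁ (S₁X s (here refl))) sX (proj₁ (S₂Y v j)) vX
        (isStable-noStrong st (lookup (interleave-⊆ˡ sp) (here refl)) (lookup (interleave-⊆ʳ sp) j) λ { refl → not-¬ sX vX })
        where
        sX = proj₂ (S₁X s (here refl))
        vX = not-X (proj₂ (S₂Y v j))
      stable : isStable T' (x ∷ S₂) ≡ true
      stable = trans (proj₁ (add-x S₂Y anticomplete)) (trans (proj₁ (same-outside τ₂)) (isStable-⊆ (interleave-⊆ʳ sp) st))
      weight-≤ : weight T S ≤ weight T' (x ∷ S₂)
      weight-≤ = begin
        weight T S                             ≡⟨ weight-interleave sp (anticomplete-X-Y S₁X S₂Y anticomplete) ⟩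
        weight T (s ∷ S₁) + weight T S₂        ≤⟨ +-monoˡ-≤ (weight T S₂) (α-upper (restrict T X) (s ∷ S₁) τ₁ (isStable-⊆ (interleave-⊆ˡ sp) st)) ⟩
        α (restrict T X) + weight T S₂         ≡⟨ cong (α (restrict T X) +_) (sym (proj₂ (same-outside τ₂))) ⟩
        α (restrict T X) + weight T' S₂        ≡⟨ sym (proj₂ (add-x S₂Y anticomplete)) ⟩
        weight T' (x ∷ S₂)                     ∎
        where open ≤-Reasoning

  down : Dominates T T'
  -- x ∉ S': S' is a stable set of T as it stands
  down S' (.x ∷ʳ τ₂) st' =
    S' , ⊆-trans τ₂ (filterᵇ-⊆ Y (verts T)) , trans (sym (proj₁ (same-outside τ₂))) st' , ≤-reflexive (proj₂ (same-outside τ₂))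
  -- x ∈ S': expand x into an optimal stable set S₁ of T[X]
  down (.x ∷ S₂) (refl ∷ τ₂) st' with α-attained (restrict T X)
  ... | S₁ , τ₁ , st₁ , wS₁ = expand (interleave-disjoint (⊆-trans τ₁ (filterᵇ-⊆ X (verts T))) (⊆-trans τ₂ (filterᵇ-⊆ Y (verts T)))
                                       (λ v i j → not-¬ (proj₂ (S₁X v i)) (not-X (proj₂ (S₂Y v j)))))
    where
    S₁X = within-filter T X τ₁
    S₂Y = within-Y τ₂
    anticomplete : ∀ v → v ∈ S₂ → StronglyAnticomplete T v X
    anticomplete v j = anticomplete-to-X x∈T xX (proj₁ (S₂Y v j)) vX
      (isStable-noStrong' st' (here refl) (there j) λ { refl → not-¬ xX vX })
      where vX = not-X (proj₂ (S₂Y v j))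
    S₁-S₂ = anticomplete-X-Y S₁X S₂Y anticomplete
    st₂ : isStable T S₂ ≡ true
    st₂ = trans (sym (proj₁ (same-outside τ₂))) (trans (sym (proj₁ (add-x S₂Y anticomplete))) st')
    expand : (Σ (List V) λ S → S ⊆ verts T × Interleaving S₁ S₂ S) →
             Σ (List V) λ S → S ⊆ verts T × isStable T S ≡ true × weight T' (x ∷ S₂) ≤ weight T S
    expand (S , τ , sp) = S , τ , trans (isStable-interleave sp S₁-S₂) (cong₂ _∧_ st₁ st₂) , ≤-reflexive (begin
      weight T' (x ∷ S₂)               ≡⟨ proj₂ (add-x S₂Y anticomplete) ⟩
      α (restrict T X) + weight T' S₂  ≡⟨ cong₂ _+_ (sym wS₁) (proj₂ (same-outside τ₂)) ⟩
      weight T S₁ + weight T S₂        ≡⟨ sym (weight-interleave sp S₁-S₂) ⟩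
      weight T S                       ∎)
      where open ≡-Reasoning

  α-block : α T ≡ α T'
  α-block = ≤-antisym (dominates⇒α≤ T T' up) (dominates⇒α≤ T' T down)

-- A stable set meets A, B, both or
-- neither; the matching "corner" {a}, {b}, {a,b} or ∅ of the block weighs
-- α of the matching "shadow" T[A], T[B], T[A ∪ B] or T[∅]. A vertex
-- y ∈ C ∪ D ∪ E ∪ F can join a vertex of A (or a) in a stable set iff
-- y ∉ C ∪ E, and a vertex of B (or b) iff y ∉ D ∪ E. This compatibility
-- condition reads the same in T and in T_Y, so stable sets translate
-- between them in both directions.
module HomogeneousPairCase {V : Set} (_≟_ : DecidableEquality V) (T : Trigraph V) (W : Weighted T)
    (lab : V → Part) (H : HomogeneousPair T lab) (small-or-proper : Small T lab ⊎ Proper T lab) where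

  open HomogeneousPair H using (A-CE; A-DF; B-DE; B-CF)

  T' : Trigraph (V ⊎ Bool)
  T' = block _≟_ T (hpair lab H small-or-proper) tt

  a b : V ⊎ Bool
  a = inj₂ true
  b = inj₂ false

  PA PB PAB PY : V → Bool
  PA  = inA ∘ₚ lab
  PB  = inB ∘ₚ lab
  PAB = inAB ∘ₚ lab
  PY  = inCDEF ∘ₚ lab

  Yl : List V
  Yl = filterᵇ PY (verts T)

  open StableSets T using (Anticomplete; isStable-interleave; weight-interleave; isStable-⊆; isStable-noStrong)
  open StableSets T' using () renaming (Anticomplete to Anticomplete'; isStable-interleave to isStable-interleave';
    weight-interleave to weight-interleave'; isStable-⊆ to isStable-⊆'; isStable-noStrong to isStable-noStrong')
  open Embedding T T' inj₁ using (Faithful; isStable-map; weight-map)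

  θ-sym : ∀ u v → u ∈ verts T → v ∈ verts T → θ T u v ≡ θ T v u
  θ-sym = WellFormed.θ-sym (Weighted.wf W)

  faithful : ∀ S → Faithful S
  faithful S = record { θ-pres = λ _ _ _ _ → refl ; w-pres = λ _ _ → refl ; wp-pres = λ _ _ _ _ → refl }

  inA⁻ : ∀ {p} → inA p ≡ true → p ≡ pA
  inA⁻ {pA} _ = refl
  inA⁻ {pB} ()
  inA⁻ {pC} ()
  inA⁻ {pD} ()
  inA⁻ {pE} ()
  inA⁻ {pF} ()

  inB⁻ : ∀ {p} → inB p ≡ true → p ≡ pB
  inB⁻ {pB} _ = refl
  inB⁻ {pA} ()
  inB⁻ {pC} ()
  inB⁻ {pD} ()
  inB⁻ {pE} ()
  inB⁻ {pF} ()

  CDEF∖CE⊆DF : ∀ p → inCDEF p ≡ true → inCE p ≡ false → inDF p ≡ true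
  CDEF∖CE⊆DF pD _ _ = refl
  CDEF∖CE⊆DF pF _ _ = refl
  CDEF∖CE⊆DF pA () _
  CDEF∖CE⊆DF pB () _
  CDEF∖CE⊆DF pC _ ()
  CDEF∖CE⊆DF pE _ ()

  CDEF∖DE⊆CF : ∀ p → inCDEF p ≡ true → inDE p ≡ false → inCF p ≡ true
  CDEF∖DE⊆CF pC _ _ = refl
  CDEF∖DE⊆CF pF _ _ = refl
  CDEF∖DE⊆CF pA () _
  CDEF∖DE⊆CF pB () _
  CDEF∖DE⊆CF pD _ ()
  CDEF∖DE⊆CF pE _ ()

  AB-disjoint-CDEF : ∀ p → inAB p ≡ true → inCDEF p ≡ true → ⊥
  AB-disjoint-CDEF p ab cdef with inAB p
  AB-disjoint-CDEF p () _ | false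
  AB-disjoint-CDEF p _ () | true

  corner : Bool → Bool → List (V ⊎ Bool)
  corner true  true  = a ∷ b ∷ []
  corner true  false = a ∷ []
  corner false true  = b ∷ []
  corner false false = []

  shadow : Bool → Bool → Part → Bool
  shadow true  true  = inAB
  shadow true  false = inA
  shadow false true  = inB
  shadow false false = λ _ → false

  corner-⊆ : ∀ ra rb → corner ra rb ⊆ a ∷ b ∷ []
  corner-⊆ true  true  = refl ∷ refl ∷ []
  corner-⊆ true  false = refl ∷ b ∷ʳ []
  corner-⊆ false true  = a ∷ʳ refl ∷ []
  corner-⊆ false false = a ∷ʳ b ∷ʳ []

  ⊆-corner : ∀ {R} → R ⊆ a ∷ b ∷ [] → Σ Bool λ ra → Σ Bool λ rb → R ≡ corner ra rb
  ⊆-corner (refl ∷ refl ∷ []) = true  , true  , refl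
  ⊆-corner (refl ∷ _ ∷ʳ [])   = true  , false , refl
  ⊆-corner (_ ∷ʳ refl ∷ [])   = false , true  , refl
  ⊆-corner (_ ∷ʳ _ ∷ʳ [])     = false , false , refl

  a∈corner : ∀ rb → a ∈ corner true rb
  a∈corner true  = here refl
  a∈corner false = here refl

  b∈corner : ∀ ra → b ∈ corner ra true
  b∈corner true  = there (here refl)
  b∈corner false = here refl

  corner-stable : ∀ ra rb → isStable T' (corner ra rb) ≡ true
  corner-stable true  true  = refl
  corner-stable true  false = refl
  corner-stable false true  = refl
  corner-stable false false = refl

  corner-weight : ∀ ra rb → weight T' (corner ra rb) ≡ α (restrict T (shadow ra rb ∘ₚ lab))
  corner-weight true  true  = +-identityʳ _
  corner-weight true  false = trans (+-identityʳ _) (+-identityʳ _)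
  corner-weight false true  = trans (+-identityʳ _) (+-identityʳ _)
  corner-weight false false = sym (α-restrict-none T)

  shadow-A⁺ : ∀ rb → shadow true rb pA ≡ true
  shadow-A⁺ true  = refl
  shadow-A⁺ false = refl

  shadow-B⁺ : ∀ ra → shadow ra true pB ≡ true
  shadow-B⁺ true  = refl
  shadow-B⁺ false = refl

  shadow-A⁻ : ∀ ra rb → shadow ra rb pA ≡ true → ra ≡ true
  shadow-A⁻ true  rb    _ = refl
  shadow-A⁻ false true  ()
  shadow-A⁻ false false ()

  shadow-B⁻ : ∀ ra rb → shadow ra rb pB ≡ true → rb ≡ true
  shadow-B⁻ ra    true  _ = refl
  shadow-B⁻ true  false ()
  shadow-B⁻ false false ()

  shadow⊆AB : ∀ ra rb p → shadow ra rb p ≡ true → inAB p ≡ true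
  shadow⊆AB true  true  p e = e
  shadow⊆AB true  false p e = cong (_∨ inB p) e
  shadow⊆AB false true  p e = trans (cong (inA p ∨_) e) (∨-zeroʳ (inA p))
  shadow⊆AB false false p ()

  Compatible : Bool → Bool → V → Set
  Compatible ra rb y = (ra ≡ true → inCE (lab y) ≡ false) × (rb ≡ true → inDE (lab y) ≡ false)

  corner-anticomplete : ∀ ra rb {S₂} → (∀ y → y ∈ S₂ → Compatible ra rb y) → Anticomplete' (map inj₁ S₂) (corner ra rb)
  corner-anticomplete ra rb h u v i k with ∈-map⁻ inj₁ i
  ... | y , j , refl = member ra rb (h y j) k
    where
    anti-if : ∀ {c} → c ≡ false → (if c then strong else anti) ≡ anti
    anti-if refl = refl
    member : ∀ ra rb {y v} → Compatible ra rb y → v ∈ corner ra rb → θ T' (inj₁ y) v ≡ anti × θ T' v (inj₁ y) ≡ anti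
    member true  true  (ce , _) (here refl)         = anti-if (ce refl) , anti-if (ce refl)
    member true  true  (_ , de) (there (here refl)) = anti-if (de refl) , anti-if (de refl)
    member true  false (ce , _) (here refl)         = anti-if (ce refl) , anti-if (ce refl)
    member false true  (_ , de) (here refl)         = anti-if (de refl) , anti-if (de refl)

  shadow-anticomplete : ∀ ra rb {S₁ S₂} → Within T (shadow ra rb ∘ₚ lab) S₁ → Within T PY S₂ →
                        (∀ y → y ∈ S₂ → Compatible ra rb y) → Anticomplete S₁ S₂
  shadow-anticomplete ra rb S₁-shadow S₂Y h u y i j =
    uy-anti , trans (sym (θ-sym u y u∈T y∈T)) uy-anti
    where
    u∈T = proj₁ (S₁-shadow u i)
    y∈T = proj₁ (S₂Y y j)
    uy-anti : θ T u y ≡ anti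
    uy-anti with lab u in la | proj₂ (S₁-shadow u i) | shadow⊆AB ra rb (lab u) (proj₂ (S₁-shadow u i))
    ... | pA | sh | _ = A-DF u u∈T la y y∈T (CDEF∖CE⊆DF (lab y) (proj₂ (S₂Y y j)) (proj₁ (h y j) (shadow-A⁻ ra rb sh)))
    ... | pB | sh | _ = B-CF u u∈T la y y∈T (CDEF∖DE⊆CF (lab y) (proj₂ (S₂Y y j)) (proj₂ (h y j) (shadow-B⁻ ra rb sh)))
    ... | pC | _ | ()
    ... | pD | _ | ()
    ... | pE | _ | ()
    ... | pF | _ | ()

  A-excludes-CE : ∀ {S u y} → isStable T S ≡ true → S ⊆ verts T → u ∈ S → lab u ≡ pA →
                  y ∈ S → PY y ≡ true → inCE (lab y) ≡ false
  A-excludes-CE {S} {u} {y} st τ i la j y∈Y with inCE (lab y) in ce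
  ... | false = refl
  ... | true  = ⊥-elim (isStable-noStrong st i j u≢y uy-strong (trans (θ-sym y u (lookup τ j) (lookup τ i)) uy-strong))
    where
    uy-strong = A-CE u (lookup τ i) la y (lookup τ j) ce
    u≢y : u ≢ y
    u≢y refl = AB-disjoint-CDEF (lab u) (cong inAB la) y∈Y

  B-excludes-DE : ∀ {S u y} → isStable T S ≡ true → S ⊆ verts T → u ∈ S → lab u ≡ pB →
                  y ∈ S → PY y ≡ true → inDE (lab y) ≡ false
  B-excludes-DE {S} {u} {y} st τ i lb j y∈Y with inDE (lab y) in de
  ... | false = refl
  ... | true  = ⊥-elim (isStable-noStrong st i j u≢y uy-strong (trans (θ-sym y u (lookup τ j) (lookup τ i)) uy-strong))
    where
    uy-strong = B-DE u (lookup τ i) lb y (lookup τ j) de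
    u≢y : u ≢ y
    u≢y refl = AB-disjoint-CDEF (lab u) (cong inAB lb) y∈Y

  a-excludes-CE : ∀ {S' y} → isStable T' S' ≡ true → a ∈ S' → inj₁ y ∈ S' → inCE (lab y) ≡ false
  a-excludes-CE {y = y} st' i j with inCE (lab y) in ce
  ... | false = refl
  ... | true  = ⊥-elim (isStable-noStrong' st' i j (λ ()) (strong-if ce) (strong-if ce))
    where
    strong-if : ∀ {c} → c ≡ true → (if c then strong else anti) ≡ strong
    strong-if refl = refl

  b-excludes-DE : ∀ {S' y} → isStable T' S' ≡ true → b ∈ S' → inj₁ y ∈ S' → inDE (lab y) ≡ false
  b-excludes-DE {y = y} st' i j with inDE (lab y) in de
  ... | false = refl
  ... | true  = ⊥-elim (isStable-noStrong' st' i j (λ ()) (strong-if de) (strong-if de))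
    where
    strong-if : ∀ {c} → c ≡ true → (if c then strong else anti) ≡ strong
    strong-if refl = refl

  -- A stable set S of T: its part S₁ in A ∪ B lies in the shadow of the
  -- corner recording whether S meets A and B, and its part S₂ outside is
  -- compatible with that corner.
  up : Dominates T' T
  up S τ st = map inj₁ S₂ ++ corner ra rb , Sublist.++⁺ (Sublist.map⁺ inj₁ S₂⊆Yl) (corner-⊆ ra rb) , stable , weight-≤
    where
    S₁ = filterᵇ PAB S
    S₂ = filterᵇ PY S
    sp : Interleaving S₁ S₂ S
    sp = interleave-filter PAB S
    S₂⊆Yl = filterᵇ-mono PY τ
    ra = any PA S₁
    rb = any PB S₁
    S₁⊆S = interleave-⊆ˡ sp
    S₂⊆S = interleave-⊆ʳ sp

    in-shadow : ∀ u → u ∈ S₁ → shadow ra rb (lab u) ≡ true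
    in-shadow u i with lab u in la | ∈-filterᵇ⁻ PAB {S} i
    ... | pA | _ = subst (λ r → shadow r rb pA ≡ true) (sym (any-∈ PA i (cong inA la))) (shadow-A⁺ rb)
    ... | pB | _ = subst (λ r → shadow ra r pB ≡ true) (sym (any-∈ PB i (cong inB la))) (shadow-B⁺ ra)
    ... | pC | ()
    ... | pD | ()
    ... | pE | ()
    ... | pF | ()

    S₁⊆shadow : S₁ ⊆ filterᵇ (shadow ra rb ∘ₚ lab) (verts T)
    S₁⊆shadow = ⊆-filterᵇ (shadow ra rb ∘ₚ lab) (⊆-trans S₁⊆S τ) in-shadow

    compatible : ∀ y → y ∈ S₂ → Compatible ra rb y
    compatible y j =
      (λ meets-A → let (u , i , uA) = any-true⁻ PA S₁ meets-A in
         A-excludes-CE st τ (lookup S₁⊆S i) (inA⁻ uA) (lookup S₂⊆S j) (∈-filterᵇ⁻ PY {S} j)) ,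
      (λ meets-B → let (u , i , uB) = any-true⁻ PB S₁ meets-B in
         B-excludes-DE st τ (lookup S₁⊆S i) (inB⁻ uB) (lookup S₂⊆S j) (∈-filterᵇ⁻ PY {S} j))

    S₁-S₂ : Anticomplete S₁ S₂
    S₁-S₂ = shadow-anticomplete ra rb (within-filter T _ S₁⊆shadow) (within-filter T PY S₂⊆Yl) compatible
    S₂-corner : Anticomplete' (map inj₁ S₂) (corner ra rb)
    S₂-corner = corner-anticomplete ra rb compatible
    glued : Interleaving (map inj₁ S₂) (corner ra rb) (map inj₁ S₂ ++ corner ra rb)
    glued = interleave-++ (map inj₁ S₂) (corner ra rb)

    stable : isStable T' (map inj₁ S₂ ++ corner ra rb) ≡ true
    stable = trans (isStable-interleave' glued S₂-corner)
      (cong₂ _∧_ (trans (isStable-map S₂ (faithful S₂)) (isStable-⊆ S₂⊆S st)) (corner-stable ra rb))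

    weight-≤ : weight T S ≤ weight T' (map inj₁ S₂ ++ corner ra rb)
    weight-≤ = begin
      weight T S                                                     ≡⟨ weight-interleave sp S₁-S₂ ⟩
      weight T S₁ + weight T S₂                                      ≤⟨ +-monoˡ-≤ (weight T S₂) (α-upper (restrict T _) S₁ S₁⊆shadow (isStable-⊆ S₁⊆S st)) ⟩
      α (restrict T (shadow ra rb ∘ₚ lab)) + weight T S₂             ≡⟨ cong₂ _+_ (sym (corner-weight ra rb)) (sym (weight-map S₂ (faithful S₂))) ⟩
      weight T' (corner ra rb) + weight T' (map inj₁ S₂)             ≡⟨ +-comm (weight T' (corner ra rb)) _ ⟩
      weight T' (map inj₁ S₂) + weight T' (corner ra rb)             ≡⟨ sym (weight-interleave' glued S₂-corner) ⟩
      weight T' (map inj₁ S₂ ++ corner ra rb)                        ∎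
      where open ≤-Reasoning

  -- A stable set of T' is S₂ ∪ R with S₂ kept and R a corner compatible
  -- with S₂; replacing R by an optimal stable set of its shadow gives a
  -- stable set of T of the same weight.
  expand-corner : ∀ ra rb S₂ → S₂ ⊆ Yl → isStable T' (map inj₁ S₂ ++ corner ra rb) ≡ true →
                  Σ (List V) λ S → S ⊆ verts T × isStable T S ≡ true × weight T' (map inj₁ S₂ ++ corner ra rb) ≤ weight T S
  expand-corner ra rb S₂ τ₂ st' with α-attained (restrict T (shadow ra rb ∘ₚ lab))
  ... | S₁ , τ₁ , st₁ , wS₁ = glue (interleave-disjoint (⊆-trans τ₁ (filterᵇ-⊆ _ (verts T))) (⊆-trans τ₂ (filterᵇ-⊆ PY (verts T)))
                                      (λ u i j → AB-disjoint-CDEF (lab u) (shadow⊆AB ra rb (lab u) (proj₂ (S₁-shadow u i))) (proj₂ (S₂Y u j))))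
    where
    S₁-shadow = within-filter T _ τ₁
    S₂Y = within-filter T PY τ₂
    glued : Interleaving (map inj₁ S₂) (corner ra rb) (map inj₁ S₂ ++ corner ra rb)
    glued = interleave-++ (map inj₁ S₂) (corner ra rb)
    kept : ∀ {y} → y ∈ S₂ → inj₁ y ∈ map inj₁ S₂ ++ corner ra rb
    kept j = ∈-++⁺ˡ (∈-map⁺ inj₁ j)
    compatible : ∀ y → y ∈ S₂ → Compatible ra rb y
    compatible y j =
      (λ { refl → a-excludes-CE st' (∈-++⁺ʳ (map inj₁ S₂) (a∈corner rb)) (kept j) }) ,
      (λ { refl → b-excludes-DE st' (∈-++⁺ʳ (map inj₁ S₂) (b∈corner ra)) (kept j) })
    S₁-S₂ = shadow-anticomplete ra rb S₁-shadow S₂Y compatible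
    S₂-corner = corner-anticomplete ra rb compatible
    st₂ : isStable T S₂ ≡ true
    st₂ = trans (sym (isStable-map S₂ (faithful S₂))) (isStable-⊆' (interleave-⊆ˡ glued) st')
    glue : (Σ (List V) λ S → S ⊆ verts T × Interleaving S₁ S₂ S) →
           Σ (List V) λ S → S ⊆ verts T × isStable T S ≡ true × weight T' (map inj₁ S₂ ++ corner ra rb) ≤ weight T S
    glue (S , τ , sp) = S , τ , trans (isStable-interleave sp S₁-S₂) (cong₂ _∧_ st₁ st₂) , ≤-reflexive (begin
      weight T' (map inj₁ S₂ ++ corner ra rb)                 ≡⟨ weight-interleave' glued S₂-corner ⟩
      weight T' (map inj₁ S₂) + weight T' (corner ra rb)      ≡⟨ cong₂ _+_ (weight-map S₂ (faithful S₂)) (corner-weight ra rb) ⟩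
      weight T S₂ + α (restrict T (shadow ra rb ∘ₚ lab))      ≡⟨ cong (weight T S₂ +_) (sym wS₁) ⟩
      weight T S₂ + weight T S₁                               ≡⟨ +-comm (weight T S₂) (weight T S₁) ⟩
      weight T S₁ + weight T S₂                               ≡⟨ sym (weight-interleave sp S₁-S₂) ⟩
      weight T S                                              ∎)
      where open ≡-Reasoning

  down : Dominates T T'
  down S' τ' st' with ⊆-++-split (map inj₁ Yl) (a ∷ b ∷ []) τ'
  ... | _ , R , refl , τ₂' , τR with ⊆-map-split inj₁ Yl τ₂' | ⊆-corner τR
  ...   | S₂ , refl , τ₂ | ra , rb , refl = expand-corner ra rb S₂ τ₂ st'

  α-block : α T ≡ α T'
  α-block = ≤-antisym (dominates⇒α≤ T T' up) (dominates⇒α≤ T' T down)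

-- Lemma 5.5: α(T) = α(T_Y).
lemma5p5 : {V : Set} (_≟_ : DecidableEquality V) (T : Trigraph V) →
    Weighted T → Monogamous T →
    (d : Decomposition T) (c : BlockChoice d) →
    α T ≡ α (block _≟_ T d c)
lemma5p5 _≟_ T W _ (hset X H) (x , x∈T , xX) = HomogeneousSetCase.α-block _≟_ T W X H x x∈T xX
lemma5p5 _≟_ T W _ (hpair lab H sp) tt       = HomogeneousPairCase.α-block _≟_ T W lab H sp
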